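{- Let $P$ be a uniformly continuously searchable closeness space with a fixed searcher $\mathcal{E}_P$, let $O$ be a pseudocloseness space, let $M:P\to O$ be uniformly continuous, and let $\Omega\in O$ be synthetically constructed from $M$, i.e. $\Omega=M(k)$ for some $k\in P$. For $\varepsilon\in\mathbb{N}$ define $\mathrm{reg}(\varepsilon,M,\Omega):=\mathcal{E}_P\big(p\mapsto C_\varepsilon(M(p),\Omega)\big)$. Then for every $\varepsilon\in\mathbb{N}$, the regressed oracle $\omega:=M(\mathrm{reg}(\varepsilon,M,\Omega))$ satisfies $C_\varepsilon(\omega,\Omega)$.
   Context: Constructive type theory. $\mathbb{N}_\infty$: decreasing binary sequences; $\underline{n}$: $n$ ones then zeros; $\infty$: all ones; $u\preceq v$ iff $\forall n\,(u_n=1\Rightarrow v_n=1)$; $\min$ pointwise. A closeness space is a type with $c:X\to X\to\mathbb{N}_\infty$ satisfying $c(x,y)=\infty\iff x=y$, symmetry, and $\min(c(x,y),c(y,z))\preceq c(x,z)$; a pseudocloseness space satisfies the same except only $x=y\Rightarrow c(x,y)=\infty$. $C_\varepsilon(x,y)$ means $\underline{\varepsilon}\preceq c(x,y)$. $M$ is uniformly continuous if for each $\varepsilon$ there is $\delta$ with $C_\delta(p_1,p_2)\Rightarrow C_\varepsilon(M(p_1),M(p_2))$. A predicate $p$ on $P$ is decidable if each $p(x)$ is decided, uniformly continuous if there is $\delta$ with $C_\delta(x_1,x_2)\Rightarrow(p(x_1)\Leftrightarrow p(x_2))$. A searcher on $P$ is a function $\mathcal{E}_P$ sending each decidable predicate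 $p$ given with a modulus of uniform continuity to an element $\mathcal{E}_P(p)\in P$ such that if some $x\in P$ satisfies $p$ then $p(\mathcal{E}_P(p))$; $P$ is uniformly continuously searchable if it has a searcher. (The predicate $p\mapsto C_\varepsilon(M(p),\Omega)$ is decidable and uniformly continuous.) -}

module Defs where

open import Data.Nat using (ℕ; zero; suc; _<_)
open import Data.Bool using (Bool; true; false)
open import Data.Product using (Σ; _×_; _,_; proj₁; ∃)
open import Relation.Nullary using (Dec; ¬_)
open import Relation.Binary.PropositionalEquality using (_≡_)
open import Function.Bundles using (_⇔_)

record ℕ∞ : Set where
  constructor mkℕ∞
  field
    seq  : ℕ → Bool
    decr : ∀ n → seq (suc n) ≡ true → seq n ≡ true
open ℕ∞ public

_⪯_ : ℕ∞ → ℕ∞ → Set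
u ⪯ v = ∀ n → seq u n ≡ true → seq v n ≡ true

-- pointwise equality of sequences (extensional reading of = on ℕ∞)
_≈∞_ : ℕ∞ → ℕ∞ → Set
u ≈∞ v = ∀ n → seq u n ≡ seq v n

underline-seq : ℕ → ℕ → Bool
underline-seq zero    _       = false
underline-seq (suc n) zero    = true
underline-seq (suc n) (suc i) = underline-seq n i

underline-decr : ∀ n i → underline-seq n (suc i) ≡ true → underline-seq n i ≡ true
underline-decr (suc n) zero    _ = Relation.Binary.PropositionalEquality.refl
underline-decr (suc n) (suc i) p = underline-decr n i p

underline : ℕ → ℕ∞
underline n = mkℕ∞ (underline-seq n) (underline-decr n)

∞ : ℕ∞
∞ = mkℕ∞ (λ _ → true) (λ _ p → p)

_∧_ : Bool → Bool → Bool
true ∧ b = b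
false ∧ _ = false

min∞ : ℕ∞ → ℕ∞ → ℕ∞
min∞ u v = mkℕ∞ (λ n → seq u n ∧ seq v n) (lem (seq u) (seq v) (decr u) (decr v))
  where
  lem : (a b : ℕ → Bool) → (∀ n → a (suc n) ≡ true → a n ≡ true)
      → (∀ n → b (suc n) ≡ true → b n ≡ true)
      → ∀ n → (a (suc n) ∧ b (suc n)) ≡ true → (a n ∧ b n) ≡ true
  lem a b da db n p with a (suc n) in ea | b (suc n) in eb
  ... | true | true with da n ea | db n eb
  ...   | x | y rewrite x | y = Relation.Binary.PropositionalEquality.refl
  lem a b da db n () | true | false
  lem a b da db n () | false | _

record IsPseudoCloseness (X : Set) (c : X → X → ℕ∞) : Set where
  field
    eq⇒∞  : ∀ x y → x ≡ y → c x y ≈∞ ∞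
    sym-c : ∀ x y → c x y ≈∞ c y x
    ultra : ∀ x y z → min∞ (c x y) (c y z) ⪯ c x z

record IsCloseness (X : Set) (c : X → X → ℕ∞) : Set where
  field
    isPseudo : IsPseudoCloseness X c
    ∞⇒eq     : ∀ x y → c x y ≈∞ ∞ → x ≡ y
  open IsPseudoCloseness isPseudo public

record PseudoClosenessSpace : Set₁ where
  field
    Carrier : Set
    c       : Carrier → Carrier → ℕ∞
    isPseudoCloseness : IsPseudoCloseness Carrier c

record ClosenessSpace : Set₁ where
  field
    Carrier : Set
    c       : Carrier → Carrier → ℕ∞
    isCloseness : IsCloseness Carrier c
  pseudo : PseudoClosenessSpace
  pseudo = record { Carrier = Carrier ; c = c
                  ; isPseudoCloseness = IsCloseness.isPseudo isCloseness }

C : (X : PseudoClosenessSpace) → ℕ → PseudoClosenessSpace.Carrier X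
  → PseudoClosenessSpace.Carrier X → Set
C X ε x y = underline ε ⪯ PseudoClosenessSpace.c X x y

UniformlyContinuous : (X Y : PseudoClosenessSpace)
  → (PseudoClosenessSpace.Carrier X → PseudoClosenessSpace.Carrier Y) → Set
UniformlyContinuous X Y f =
  ∀ ε → Σ ℕ λ δ → ∀ x₁ x₂ → C X δ x₁ x₂ → C Y ε (f x₁) (f x₂)

DecidablePred : (X : Set) → (X → Set) → Set
DecidablePred X p = ∀ x → Dec (p x)

IsUCModulus : (X : PseudoClosenessSpace) → (PseudoClosenessSpace.Carrier X → Set) → ℕ → Set
IsUCModulus X p δ = ∀ x₁ x₂ → C X δ x₁ x₂ → (p x₁ ⇔ p x₂)

record Searcher (X : PseudoClosenessSpace) : Set₁ where
  field
    search : (p : PseudoClosenessSpace.Carrier X → Set) → DecidablePred _ p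
           → (δ : ℕ) → IsUCModulus X p δ → PseudoClosenessSpace.Carrier X
    correct : (p : PseudoClosenessSpace.Carrier X → Set) (d : DecidablePred _ p)
              (δ : ℕ) (φ : IsUCModulus X p δ)
            → Σ (PseudoClosenessSpace.Carrier X) p → p (search p d δ φ)

regPred : (P : ClosenessSpace) (O : PseudoClosenessSpace)
  → (ClosenessSpace.Carrier P → PseudoClosenessSpace.Carrier O)
  → PseudoClosenessSpace.Carrier O → ℕ → ClosenessSpace.Carrier P → Set
regPred P O M Ω ε p = C O ε (M p) Ω

reg : (P : ClosenessSpace) (E : Searcher (ClosenessSpace.pseudo P)) (O : PseudoClosenessSpace)
  → (ε : ℕ) (M : ClosenessSpace.Carrier P → PseudoClosenessSpace.Carrier O)
  → (Ω : PseudoClosenessSpace.Carrier O)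
  → DecidablePred _ (regPred P O M Ω ε)
  → (δ : ℕ) → IsUCModulus (ClosenessSpace.pseudo P) (regPred P O M Ω ε) δ
  → ClosenessSpace.Carrier P
reg P E O ε M Ω d δ φ = Searcher.search E (regPred P O M Ω ε) d δ φ

-- Since Ω = M k, the point k itself satisfies C_ε(M k, Ω) by reflexivity of
-- closeness, so the predicate handed to the searcher is satisfiable and the
-- searcher's correctness applies.
module Submission where

open import Defs
open import Data.Nat using (ℕ)
open import Data.Product using (Σ; _,_)
open import Relation.Binary.PropositionalEquality using (_≡_; refl)

≈∞-∞⇒⪰ : ∀ {u} → u ≈∞ ∞ → ∀ v → v ⪯ u
≈∞-∞⇒⪰ u≈∞ v n _ = u≈∞ n

C-refl : (X : PseudoClosenessSpace) (ε : ℕ) (x : PseudoClosenessSpace.Carrier X) → C X ε x x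
C-refl X ε x =
  ≈∞-∞⇒⪰ {PseudoClosenessSpace.c X x x}
    (IsPseudoCloseness.eq⇒∞ (PseudoClosenessSpace.isPseudoCloseness X) x x refl)
    (underline ε)

theorem4p36 : (P : ClosenessSpace) (E : Searcher (ClosenessSpace.pseudo P))
    (O : PseudoClosenessSpace)
    (M : ClosenessSpace.Carrier P → PseudoClosenessSpace.Carrier O)
    → UniformlyContinuous (ClosenessSpace.pseudo P) O M
    → (Ω : PseudoClosenessSpace.Carrier O)
    → Σ (ClosenessSpace.Carrier P) (λ k → Ω ≡ M k)
    → (ε : ℕ)
    → (d : DecidablePred (ClosenessSpace.Carrier P) (regPred P O M Ω ε))
    → (δ : ℕ) → (φ : IsUCModulus (ClosenessSpace.pseudo P) (regPred P O M Ω ε) δ)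
    → C O ε (M (reg P E O ε M Ω d δ φ)) Ω
theorem4p36 P E O M _ Ω (k , refl) ε d δ φ =
  Searcher.correct E (regPred P O M Ω ε) d δ φ (k , C-refl O ε (M k))
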